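{- Let $n$ and $k$ be integers with $0<k<n$. Let $\alpha$ and $\beta$ be sequences in $\mathbb{Z}_n$ with $|\alpha|+|\beta|=n-1+k$, $L(\alpha)<n$ and $L(1-\beta)<n$. Then: (a) The union $\alpha\cup\beta$ contains no subsequence of length $n$ with sum zero. (b) $k\le|\alpha|<n$, $k\le|\beta|<n$, and $\overline{b}-\overline{a}\ge k$ for all terms $a$ of $\alpha$ and $b$ of $\beta$; in particular $a\ne b$ for all terms $a$ of $\alpha$ and $b$ of $\beta$. (c) Let $u$ and $v$ be the multiplicities of $1$ and $0$ in $\alpha\cup\beta$. Then $u+v\ge 2k$, $\max(u,v)\ge k$, and $\min(u,v)\ge 2k-n+1$. Moreover, $u+v=2k$ holds if and only if $\alpha=1^{2p-n+1}2^{n-1-p}$ and $\beta=0^{2q-n+1}(-1)^{n-1-q}$ for some integers $p,q$ with $(n-1)/2\le p<n$, $(n-1)/2\le q<n$ and $p+q=n-1+k$. Also, $\max(u,v)=k$ holds if and only if $n$ and $k$ have different parity and $\alpha=1^{k}2^{(n-1-k)/2}$, $\beta=0^{k}(-1)^{(n-1-k)/2}$. (d) If $k\ge(n-1)/2$, then the highest multiplicity of a term in $\alpha\cup\beta$ equals $\max(u,v)$.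
   Context: $\mathbb{Z}_n=\mathbb{Z}/n\mathbb{Z}$. Sequences are finite, considered up to rearrangement, and written multiplicatively: $x^m$ denotes the term $x$ repeated $m$ times, and juxtaposition denotes concatenation; the symbols $0,1,2,-1$ in such expressions denote the corresponding elements of $\mathbb{Z}_n$. $|\omega|$ is the length of $\omega$. For $a\in\mathbb{Z}_n$, $\overline{a}$ is the unique integer in $[1,n]$ in the class $a$ (so $\overline{0}=n$). $L(\omega)$ is the integer sum of $\overline{c}$ over the terms $c$ of $\omega$ (empty sequence: $0$). $1-\beta$ is the sequence obtained by replacing each term $b$ of $\beta$ by $1-b$. $\alpha\cup\beta$ is the sequence of all terms of $\alpha$ and of $\beta$ together. -}

module Defs where

open import Data.Nat using (ℕ; zero; suc; _+_; _*_; _∸_; NonZero; _⊔_)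
open import Data.Nat.DivMod using (_mod_)
open import Data.Fin using (Fin; toℕ; _≟_)
open import Data.List using (List; []; _∷_; map; foldr)
open import Data.Nat.ListAction using (sum)
open import Relation.Nullary using (yes; no)

[_]ₙ : ∀ {n} .{{_ : NonZero n}} → ℕ → Fin n
[_]ₙ {n} m = m mod n

-- Sequences in Z_n: lists of elements of Z_n (considered up to rearrangement,
-- i.e. equality of sequences is the permutation relation _↭_).
Seq : ℕ → Set
Seq n = List (Fin n)

bar : ∀ {n} → Fin n → ℕ
bar {n} a with toℕ a
... | zero = n
... | suc m = suc m

L : ∀ {n} → Seq n → ℕ
L ω = sum (map bar ω)

oneMinus : ∀ {n} .{{_ : NonZero n}} → Seq n → Seq n
oneMinus {n} β = map (λ b → [ suc n ∸ toℕ b ]ₙ) β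

sumZ : ∀ {n} .{{_ : NonZero n}} → Seq n → Fin n
sumZ ω = [ sum (map toℕ ω) ]ₙ

mult : ∀ {n} → Fin n → Seq n → ℕ
mult x [] = 0
mult x (y ∷ ω) with x ≟ y
... | yes _ = suc (mult x ω)
... | no _ = mult x ω

highestMult : ∀ {n} → Seq n → ℕ
highestMult ω = foldr (λ x m → mult x ω ⊔ m) 0 ω

{-# OPTIONS --safe #-}
-- Weigh each term c of Z_n by bar c ∈ [1, n]. All weights are at least 1, so L α < n forces
-- |α| < n and bar a + |α| ≤ n for every term a of α; every term other than 1 weighs at least 2,
-- so L α < n also forces 2|α| < mult 1 α + n, with equality only if α consists of 1s and 2s.
-- The hypothesis on β says that 1 - β satisfies the same condition, so all of this applies to
-- 1 - β and transfers back to β with 0 in the role of 1, using bar b + bar (1 - b) = n + 1.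
-- Adding the bounds for α and β against |α| + |β| = n - 1 + k gives (b), (c) and (d), and the
-- equality cases of (c) are those in which both length bounds are tight. For (a), a subsequence
-- ω₁ ++ ω₂ of length n with ω₁ ⊆ α and ω₂ ⊆ β has sum ≡ L ω₁ + |ω₂| - L (1 - ω₂) (mod n), and
-- this number lies strictly between 0 and n.
module Submission where

open import Defs
open import Data.Empty using (⊥)
open import Data.Fin using (Fin; toℕ; _≟_)
open import Data.Fin.Properties using (toℕ-fromℕ<; toℕ-injective; toℕ<n)
open import Data.List using (List; []; _∷_; length; _++_; replicate; map; filter; foldr)
open import Data.List.Properties
  using (length-++; length-filter; length-map; map-++; map-∘; map-cong; map-id; map-replicate)
open import Data.List.Membership.Propositional using (_∈_; _∉_)
open import Data.List.Membership.Propositional.Properties using (∈-map⁺; ∈-++⁻)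
open import Data.List.Relation.Binary.Permutation.Propositional
  using (_↭_; prep; ↭-refl; module PermutationReasoning)
open import Data.List.Relation.Binary.Permutation.Propositional.Properties
  using (↭-length; filter-↭; shift) renaming (map⁺ to ↭-map⁺)
open import Data.List.Relation.Binary.Sublist.Propositional using (_⊆_; []; _∷_; _∷ʳ_)
open import Data.List.Relation.Binary.Sublist.Propositional.Properties using () renaming (map⁺ to ⊆-map⁺)
open import Data.List.Relation.Unary.All using (All; []; _∷_)
open import Data.List.Relation.Unary.Any using (here; there; any?)
open import Data.Nat using (ℕ; zero; suc; _+_; _*_; _∸_; _≤_; _<_; _⊔_; _⊓_; _/_; _%_; z≤n; s≤s; s≤s⁻¹;
  NonZero; >-nonZero; >-nonZero⁻¹)
open import Data.Nat.Divisibility using (_∣_; m%n≡0⇒n∣m; ∣m+n∣m⇒∣n; n∣m*n; >⇒∤)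
open import Data.Nat.DivMod using (m%n<n; n%n≡0; m<n⇒m%n≡m; [m+n]%n≡m%n; [m+kn]%n≡m%n; m*n/n≡m; %-distribˡ-+)
open import Data.Nat.ListAction using (sum)
open import Data.Nat.ListAction.Properties using (sum-++)
open import Data.Nat.Properties hiding (_≟_)
open import Data.Nat.Tactic.RingSolver using (solve-∀)
open import Algebra.Properties.CommutativeSemigroup +-commutativeSemigroup
  using () renaming (interchange to +-interchange; x∙yz≈y∙xz to +-left-comm)
open import Data.Product using (Σ; _×_; _,_; ∃₂)
open import Data.Sum using (_⊎_; inj₁; inj₂)
open import Function using (_∘_)
open import Function.Bundles using (_⇔_; mk⇔)
open import Function.Definitions using (Injective)
open import Relation.Binary.PropositionalEquality
  using (_≡_; _≢_; refl; sym; trans; cong; cong₂; subst; subst₂; module ≡-Reasoning)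
open import Relation.Nullary using (¬_; yes; no; contradiction)

2*m≡m+m : ∀ m → 2 * m ≡ m + m
2*m≡m+m m = cong (m +_) (+-identityʳ m)

1+m%2≢m%2 : ∀ m → suc m % 2 ≢ m % 2
1+m%2≢m%2 zero ()
1+m%2≢m%2 (suc m) eq = 1+m%2≢m%2 m (sym (begin
  m % 2             ≡⟨ [m+n]%n≡m%n m 2 ⟨
  (m + 2) % 2       ≡⟨ cong (_% 2) (+-comm m 2) ⟩
  suc (suc m) % 2   ≡⟨ eq ⟩
  suc m % 2         ∎))
  where open ≡-Reasoning

+-tight : ∀ {a b c d} → a ≤ b → c ≤ d → b + d ≤ a + c → a ≡ b × c ≡ d
+-tight {a} {b} {c} {d} a≤b c≤d b+d≤a+c =
  ≤-antisym a≤b (+-cancelʳ-≤ c b a (≤-trans (+-monoʳ-≤ b c≤d) b+d≤a+c)) ,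
  ≤-antisym c≤d (+-cancelˡ-≤ a d c (≤-trans (+-monoˡ-≤ d a≤b) b+d≤a+c))

-- x ≡ d ∸ c (mod n) with 0 < d ∸ c < n.
∤-gap : ∀ {n x c d m} → n ∣ x → x + c ≡ m * n + d → c < d → d < c + n → ⊥
∤-gap {n} {x} {c} {d} {m} n∣x eq c<d d<c+n = >⇒∤ {{>-nonZero 0<r}} r<n n∣r
  where
  r : ℕ
  r = d ∸ c
  x≡m*n+r : x ≡ m * n + r
  x≡m*n+r = +-cancelʳ-≡ c x (m * n + r)
    (trans eq (trans (cong (m * n +_) (sym (m∸n+n≡m (<⇒≤ c<d)))) (sym (+-assoc (m * n) r c))))
  n∣r : n ∣ r
  n∣r = ∣m+n∣m⇒∣n (subst (n ∣_) x≡m*n+r n∣x) (n∣m*n m)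
  0<r : 0 < r
  0<r = m<n⇒0<n∸m c<d
  r<n : r < n
  r<n = subst (r <_) (m+n∸m≡n c n) (∸-monoˡ-< d<c+n (<⇒≤ c<d))

[2*p+1]+[2*q+1]≡2*k+[n+n] : ∀ {p q s k} → p + q ≡ s + k → (2 * p + 1) + (2 * q + 1) ≡ 2 * k + (suc s + suc s)
[2*p+1]+[2*q+1]≡2*k+[n+n] {p} {q} {s} {k} p+q≡s+k = begin
  (2 * p + 1) + (2 * q + 1)   ≡⟨ lhs p q ⟩
  2 * (p + q) + 2             ≡⟨ cong (λ t → 2 * t + 2) p+q≡s+k ⟩
  2 * (s + k) + 2             ≡⟨ rhs s k ⟩
  2 * k + (suc s + suc s)     ∎
  where
  open ≡-Reasoning
  lhs : ∀ p q → (2 * p + 1) + (2 * q + 1) ≡ 2 * (p + q) + 2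
  lhs = solve-∀
  rhs : ∀ s k → 2 * (s + k) + 2 ≡ 2 * k + (suc s + suc s)
  rhs = solve-∀

[2*p+1∸n]+[2*q+1∸n]≡2*k : ∀ {p q s k} → s ≤ 2 * p → s ≤ 2 * q → p + q ≡ s + k →
                          (2 * p + 1 ∸ suc s) + (2 * q + 1 ∸ suc s) ≡ 2 * k
[2*p+1∸n]+[2*q+1∸n]≡2*k {p} {q} {s} {k} s≤2p s≤2q p+q≡s+k = +-cancelʳ-≡ (suc s + suc s) _ _ (begin
  (x + y) + (suc s + suc s)    ≡⟨ +-interchange x y (suc s) (suc s) ⟩
  (x + suc s) + (y + suc s)    ≡⟨ cong₂ _+_ (m∸n+n≡m (n≤2*m+1 p s≤2p)) (m∸n+n≡m (n≤2*m+1 q s≤2q)) ⟩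
  (2 * p + 1) + (2 * q + 1)    ≡⟨ [2*p+1]+[2*q+1]≡2*k+[n+n] {p} {q} p+q≡s+k ⟩
  2 * k + (suc s + suc s)      ∎)
  where
  open ≡-Reasoning
  x y : ℕ
  x = 2 * p + 1 ∸ suc s
  y = 2 * q + 1 ∸ suc s
  n≤2*m+1 : ∀ m → s ≤ 2 * m → suc s ≤ 2 * m + 1
  n≤2*m+1 m s≤2m = subst (suc s ≤_) (+-comm 1 (2 * m)) (s≤s s≤2m)

2*k+1∸n≤x : ∀ {k m x s} → k ≤ m → 2 * m + 1 ≤ x + suc s → 2 * k + 1 ∸ suc s ≤ x
2*k+1∸n≤x {k} {m} {x} {s} k≤m 2m+1≤x+n = m≤n+o⇒m∸n≤o (2 * k + 1) (suc s) (begin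
  2 * k + 1    ≤⟨ +-monoˡ-≤ 1 (*-monoʳ-≤ 2 k≤m) ⟩
  2 * m + 1    ≤⟨ 2m+1≤x+n ⟩
  x + suc s    ≡⟨ +-comm x (suc s) ⟩
  suc s + x    ∎)
  where open ≤-Reasoning

c+m<1+s⇒c≤k : ∀ {c m k s} → c + m < suc s → k ≤ m → s ≤ 2 * k → c ≤ k
c+m<1+s⇒c≤k {c} {m} {k} {s} c+m<n k≤m s≤2k = +-cancelʳ-≤ k c k (begin
  c + k        ≤⟨ +-monoʳ-≤ c k≤m ⟩
  c + m        ≤⟨ s≤s⁻¹ c+m<n ⟩
  s            ≤⟨ s≤2k ⟩
  2 * k        ≡⟨ 2*m≡m+m k ⟩
  k + k        ∎)
  where open ≤-Reasoning

-- The equality case 2m + 1 = a + n of the bound 2 |α| < mult 1 α + n, with n = suc s.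
module _ {a s : ℕ} (m : ℕ) (tight : 2 * m + 1 ≡ a + suc s) where

  private
    s+a≡m+m : s + a ≡ m + m
    s+a≡m+m = suc-injective (begin
      suc (s + a)   ≡⟨ cong suc (+-comm s a) ⟩
      suc (a + s)   ≡⟨ +-suc a s ⟨
      a + suc s     ≡⟨ tight ⟨
      2 * m + 1     ≡⟨ +-comm (2 * m) 1 ⟩
      suc (2 * m)   ≡⟨ cong suc (2*m≡m+m m) ⟩
      suc (m + m)   ∎)
      where open ≡-Reasoning

  tight⇒s≤2*m : s ≤ 2 * m
  tight⇒s≤2*m = s≤s⁻¹ (begin
    suc s        ≤⟨ m≤n+m (suc s) a ⟩
    a + suc s    ≡⟨ tight ⟨
    2 * m + 1    ≡⟨ +-comm (2 * m) 1 ⟩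
    suc (2 * m)  ∎)
    where open ≤-Reasoning

  tight⇒a≡2*m+1∸n : a ≡ 2 * m + 1 ∸ suc s
  tight⇒a≡2*m+1∸n = sym (trans (cong (_∸ suc s) tight) (m+n∸n≡m a (suc s)))

  module _ (a≤m : a ≤ m) where

    private
      d : ℕ
      d = m ∸ a

      s≡d+m : s ≡ d + m
      s≡d+m = +-cancelʳ-≡ a s (d + m) (begin
        s + a          ≡⟨ s+a≡m+m ⟩
        m + m          ≡⟨ cong (_+ m) (m∸n+n≡m a≤m) ⟨
        (d + a) + m    ≡⟨ +-assoc d a m ⟩
        d + (a + m)    ≡⟨ cong (d +_) (+-comm a m) ⟩
        d + (m + a)    ≡⟨ +-assoc d m a ⟨
        (d + m) + a    ∎)
        where open ≡-Reasoning

      s≡a+d*2 : s ≡ a + d * 2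
      s≡a+d*2 = begin
        s              ≡⟨ s≡d+m ⟩
        d + m          ≡⟨ cong (d +_) (m∸n+n≡m a≤m) ⟨
        d + (d + a)    ≡⟨ d+[d+a]≡a+d*2 d a ⟩
        a + d * 2      ∎
        where
        open ≡-Reasoning
        d+[d+a]≡a+d*2 : ∀ d a → d + (d + a) ≡ a + d * 2
        d+[d+a]≡a+d*2 = solve-∀

    tight⇒m∸a≡s∸m : m ∸ a ≡ s ∸ m
    tight⇒m∸a≡s∸m = sym (trans (cong (_∸ m) s≡d+m) (m+n∸n≡m d m))

    tight⇒s∸m≡[s∸a]/2 : s ∸ m ≡ (s ∸ a) / 2
    tight⇒s∸m≡[s∸a]/2 = sym (begin
      (s ∸ a) / 2            ≡⟨ cong (λ t → (t ∸ a) / 2) s≡a+d*2 ⟩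
      (a + d * 2 ∸ a) / 2    ≡⟨ cong (_/ 2) (m+n∸m≡n a (d * 2)) ⟩
      d * 2 / 2              ≡⟨ m*n/n≡m d 2 ⟩
      d                      ≡⟨ tight⇒m∸a≡s∸m ⟩
      s ∸ m                  ∎)
      where open ≡-Reasoning

    tight⇒parity : suc s % 2 ≢ a % 2
    tight⇒parity eq = 1+m%2≢m%2 a (begin
      suc a % 2              ≡⟨ [m+kn]%n≡m%n (suc a) d 2 ⟨
      (suc a + d * 2) % 2    ≡⟨ cong (λ t → suc t % 2) s≡a+d*2 ⟨
      suc s % 2              ≡⟨ eq ⟩
      a % 2                  ∎)
      where open ≡-Reasoning

⊆-++⁻ : ∀ {A : Set} (xs : List A) {ys ω} → ω ⊆ xs ++ ys →
        ∃₂ λ ω₁ ω₂ → ω ≡ ω₁ ++ ω₂ × ω₁ ⊆ xs × ω₂ ⊆ ys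
⊆-++⁻ [] ω⊆ys = [] , _ , refl , [] , ω⊆ys
⊆-++⁻ (x ∷ xs) (.x ∷ʳ ω⊆) with ⊆-++⁻ xs ω⊆
... | ω₁ , ω₂ , refl , ω₁⊆xs , ω₂⊆ys = ω₁ , ω₂ , refl , x ∷ʳ ω₁⊆xs , ω₂⊆ys
⊆-++⁻ (x ∷ xs) (refl ∷ ω⊆) with ⊆-++⁻ xs ω⊆
... | ω₁ , ω₂ , refl , ω₁⊆xs , ω₂⊆ys = x ∷ ω₁ , ω₂ , refl , refl ∷ ω₁⊆xs , ω₂⊆ys

module _ {n : ℕ} where

  mult≡length-filter : ∀ (x : Fin n) ω → mult x ω ≡ length (filter (x ≟_) ω)
  mult≡length-filter x [] = refl
  mult≡length-filter x (y ∷ ω) with x ≟ y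
  ... | yes _ = cong suc (mult≡length-filter x ω)
  ... | no _ = mult≡length-filter x ω

  mult-↭ : ∀ (x : Fin n) {xs ys} → xs ↭ ys → mult x xs ≡ mult x ys
  mult-↭ x {xs} {ys} xs↭ys = begin
    mult x xs                   ≡⟨ mult≡length-filter x xs ⟩
    length (filter (x ≟_) xs)   ≡⟨ ↭-length (filter-↭ (x ≟_) xs↭ys) ⟩
    length (filter (x ≟_) ys)   ≡⟨ mult≡length-filter x ys ⟨
    mult x ys                   ∎
    where open ≡-Reasoning

  mult≤length : ∀ (x : Fin n) ω → mult x ω ≤ length ω
  mult≤length x ω = subst (_≤ length ω) (sym (mult≡length-filter x ω)) (length-filter (x ≟_) ω)

  mult-++ : ∀ (x : Fin n) xs ys → mult x (xs ++ ys) ≡ mult x xs + mult x ys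
  mult-++ x [] ys = refl
  mult-++ x (y ∷ xs) ys with x ≟ y
  ... | yes _ = cong suc (mult-++ x xs ys)
  ... | no _ = mult-++ x xs ys

  mult-∉ : ∀ {x : Fin n} {ω} → x ∉ ω → mult x ω ≡ 0
  mult-∉ {x} {[]} _ = refl
  mult-∉ {x} {y ∷ ω} x∉ with x ≟ y
  ... | yes x≡y = contradiction (here x≡y) x∉
  ... | no _ = mult-∉ (x∉ ∘ there)

  mult-++-∉ʳ : ∀ {x : Fin n} xs {ys} → x ∉ ys → mult x (xs ++ ys) ≡ mult x xs
  mult-++-∉ʳ {x} xs {ys} x∉ys =
    trans (mult-++ x xs ys) (trans (cong (mult x xs +_) (mult-∉ x∉ys)) (+-identityʳ _))

  mult-++-∉ˡ : ∀ {x : Fin n} {xs} ys → x ∉ xs → mult x (xs ++ ys) ≡ mult x ys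
  mult-++-∉ˡ {x} {xs} ys x∉xs = trans (mult-++ x xs ys) (cong (_+ mult x ys) (mult-∉ x∉xs))

  mult-replicate-self : ∀ (x : Fin n) c → mult x (replicate c x) ≡ c
  mult-replicate-self x zero = refl
  mult-replicate-self x (suc c) with x ≟ x
  ... | yes _ = cong suc (mult-replicate-self x c)
  ... | no x≢x = contradiction refl x≢x

  mult-replicate-other : ∀ {x y : Fin n} c → x ≢ y → mult x (replicate c y) ≡ 0
  mult-replicate-other zero _ = refl
  mult-replicate-other {x} {y} (suc c) x≢y with x ≟ y
  ... | yes x≡y = contradiction x≡y x≢y
  ... | no _ = mult-replicate-other c x≢y

  mult-replicate-++ : ∀ {x y : Fin n} c d → x ≢ y → mult x (replicate c x ++ replicate d y) ≡ c
  mult-replicate-++ {x} {y} c d x≢y = begin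
    mult x (replicate c x ++ replicate d y)           ≡⟨ mult-++ x (replicate c x) (replicate d y) ⟩
    mult x (replicate c x) + mult x (replicate d y)   ≡⟨ cong₂ _+_ (mult-replicate-self x c) (mult-replicate-other d x≢y) ⟩
    c + 0                                             ≡⟨ +-identityʳ c ⟩
    c                                                 ∎
    where open ≡-Reasoning

  mult-map : ∀ {m} {f : Fin m → Fin n} → Injective _≡_ _≡_ f → ∀ x ω → mult (f x) (map f ω) ≡ mult x ω
  mult-map f-inj x [] = refl
  mult-map {f = f} f-inj x (y ∷ ω) with f x ≟ f y | x ≟ y
  ... | yes _ | yes _ = cong suc (mult-map f-inj x ω)
  ... | no _ | no _ = mult-map f-inj x ω
  ... | yes fx≡fy | no x≢y = contradiction (f-inj fx≡fy) x≢y
  ... | no fx≢fy | yes refl = contradiction refl fx≢fy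

  ↭-two-values : ∀ {e f : Fin n} {ω} → All (λ y → y ≡ e ⊎ y ≡ f) ω →
                 ω ↭ replicate (mult e ω) e ++ replicate (length ω ∸ mult e ω) f
  ↭-two-values [] = ↭-refl
  ↭-two-values {e} {f} {y ∷ ω} (y∈ef ∷ ω∈ef) with e ≟ y | y∈ef
  ... | yes refl | _ = prep e (↭-two-values ω∈ef)
  ... | no e≢y | inj₁ y≡e = contradiction (sym y≡e) e≢y
  ... | no _ | inj₂ refl = begin
    f ∷ ω                                                              ↭⟨ prep f (↭-two-values ω∈ef) ⟩
    f ∷ replicate (mult e ω) e ++ replicate (length ω ∸ mult e ω) f    ↭⟨ shift f (replicate (mult e ω) e) _ ⟨
    replicate (mult e ω) e ++ replicate (suc (length ω ∸ mult e ω)) f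
      ≡⟨ cong (λ c → replicate (mult e ω) e ++ replicate c f) (+-∸-assoc 1 (mult≤length e ω)) ⟨
    replicate (mult e ω) e ++ replicate (suc (length ω) ∸ mult e ω) f  ∎
    where open PermutationReasoning

  module _ (ω : Seq n) where

    private
      maxMult : List (Fin n) → ℕ
      maxMult = foldr (λ y m → mult y ω ⊔ m) 0

      ∈⇒mult≤maxMult : ∀ {x ys} → x ∈ ys → mult x ω ≤ maxMult ys
      ∈⇒mult≤maxMult (here refl) = m≤m⊔n _ _
      ∈⇒mult≤maxMult (there x∈ys) = ≤-trans (∈⇒mult≤maxMult x∈ys) (m≤n⊔m _ _)

      maxMult-lub : ∀ {M} ys → (∀ {x} → x ∈ ys → mult x ω ≤ M) → maxMult ys ≤ M
      maxMult-lub [] _ = z≤n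
      maxMult-lub (y ∷ ys) bound = ⊔-lub (bound (here refl)) (maxMult-lub ys (bound ∘ there))

    mult≤highestMult : ∀ x → mult x ω ≤ highestMult ω
    mult≤highestMult x with any? (x ≟_) ω
    ... | yes x∈ω = ∈⇒mult≤maxMult x∈ω
    ... | no x∉ω = subst (_≤ highestMult ω) (sym (mult-∉ x∉ω)) z≤n

    highestMult-lub : ∀ {M} → (∀ {x} → x ∈ ω → mult x ω ≤ M) → highestMult ω ≤ M
    highestMult-lub = maxMult-lub ω

-- Representatives in [1, n] and the reflection b ↦ 1 - b

module _ {n : ℕ} .{{_ : NonZero n}} where

  toℕ-[]ₙ : ∀ m → toℕ ([_]ₙ {n} m) ≡ m % n
  toℕ-[]ₙ m = toℕ-fromℕ< (m%n<n m n)

  []ₙ-cong : ∀ {m m′} → m % n ≡ m′ % n → [ m ]ₙ ≡ [_]ₙ {n} m′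
  []ₙ-cong {m} {m′} eq = toℕ-injective (trans (toℕ-[]ₙ m) (trans eq (sym (toℕ-[]ₙ m′))))

  bar-suc : ∀ {x : Fin n} {t} → toℕ x ≡ suc t → bar x ≡ suc t
  bar-suc {Fin.suc _} eq = eq

  bar-zero : ∀ {x : Fin n} → toℕ x ≡ 0 → bar x ≡ n
  bar-zero {Fin.zero} _ = refl

  0<bar : ∀ (x : Fin n) → 0 < bar x
  0<bar Fin.zero = s≤s z≤n
  0<bar (Fin.suc _) = s≤s z≤n

  bar≤n : ∀ (x : Fin n) → bar x ≤ n
  bar≤n Fin.zero = ≤-refl
  bar≤n (Fin.suc x) = s≤s (<⇒≤ (toℕ<n x))

  bar%n : ∀ (x : Fin n) → bar x % n ≡ toℕ x % n
  bar%n Fin.zero = n%n≡0 n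
  bar%n (Fin.suc _) = refl

  []ₙ-bar : ∀ (x : Fin n) → [ bar x ]ₙ ≡ x
  []ₙ-bar x = toℕ-injective (trans (toℕ-[]ₙ (bar x)) (trans (bar%n x) (m<n⇒m%n≡m (toℕ<n x))))

  bar-injective : ∀ {x y : Fin n} → bar x ≡ bar y → x ≡ y
  bar-injective {x} {y} eq = trans (sym ([]ₙ-bar x)) (trans (cong [_]ₙ eq) ([]ₙ-bar y))

  bar-[]ₙ : ∀ {c} → 0 < c → c ≤ n → bar ([_]ₙ {n} c) ≡ c
  bar-[]ₙ {suc c} _ c≤n with m≤n⇒m<n∨m≡n c≤n
  ... | inj₁ c<n = bar-suc (trans (toℕ-[]ₙ (suc c)) (m<n⇒m%n≡m c<n))
  ... | inj₂ refl = bar-zero (trans (toℕ-[]ₙ n) (n%n≡0 n))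

  bar[0] : bar ([_]ₙ {n} 0) ≡ n
  bar[0] = bar-zero (trans (toℕ-[]ₙ 0) (m<n⇒m%n≡m (>-nonZero⁻¹ n)))

  bar[1] : bar ([_]ₙ {n} 1) ≡ 1
  bar[1] = bar-[]ₙ (s≤s z≤n) (>-nonZero⁻¹ n)

  ≢[1]⇒2≤bar : ∀ {x : Fin n} → x ≢ [ 1 ]ₙ → 2 ≤ bar x
  ≢[1]⇒2≤bar {x} x≢1 = ≤∧≢⇒< (0<bar x) (λ 1≡bar → x≢1 (trans (sym ([]ₙ-bar x)) (cong [_]ₙ (sym 1≡bar))))

  [1]≢[2] : 2 ≤ n → [_]ₙ {n} 1 ≢ [ 2 ]ₙ
  [1]≢[2] 2≤n [1]≡[2] = contradiction (trans (sym bar[1]) (trans (cong bar [1]≡[2]) (bar-[]ₙ (s≤s z≤n) 2≤n))) λ ()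

  [0]≢[n∸1] : 2 ≤ n → [_]ₙ {n} 0 ≢ [ n ∸ 1 ]ₙ
  [0]≢[n∸1] 2≤n [0]≡[n∸1] =
    <⇒≢ (≤-reflexive (suc-pred n))
      (sym (trans (sym bar[0]) (trans (cong bar [0]≡[n∸1]) (bar-[]ₙ (m<n⇒0<n∸m 2≤n) (m∸n≤m n 1)))))

  -- The pointwise map of Defs.oneMinus, so that oneMinus ω is definitionally map 1-_ ω.
  1-_ : Fin n → Fin n
  1- b = [ suc n ∸ toℕ b ]ₙ

  bar-1- : ∀ (x : Fin n) → bar (1- x) ≡ suc n ∸ bar x
  bar-1- Fin.zero = begin
    bar ([_]ₙ {n} (suc n))   ≡⟨ cong bar ([]ₙ-cong {suc n} {1} ([m+n]%n≡m%n 1 n)) ⟩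
    bar ([_]ₙ {n} 1)         ≡⟨ bar[1] ⟩
    1                        ≡⟨ m+n∸n≡m 1 n ⟨
    suc n ∸ n                ∎
    where open ≡-Reasoning
  bar-1- (Fin.suc t) = bar-[]ₙ (m<n⇒0<n∸m (m<n⇒m<1+n (toℕ<n t))) (m∸n≤m n (toℕ t))

  bar+bar-1- : ∀ (x : Fin n) → bar x + bar (1- x) ≡ suc n
  bar+bar-1- x = trans (cong (bar x +_) (bar-1- x)) (m+[n∸m]≡n (m≤n⇒m≤1+n (bar≤n x)))

  1--involutive : ∀ (x : Fin n) → 1- (1- x) ≡ x
  1--involutive x = bar-injective (begin
    bar (1- (1- x))           ≡⟨ bar-1- (1- x) ⟩
    suc n ∸ bar (1- x)        ≡⟨ cong (suc n ∸_) (bar-1- x) ⟩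
    suc n ∸ (suc n ∸ bar x)   ≡⟨ m∸[m∸n]≡n (m≤n⇒m≤1+n (bar≤n x)) ⟩
    bar x                     ∎)
    where open ≡-Reasoning

  1--injective : Injective _≡_ _≡_ 1-_
  1--injective {x} {y} eq = trans (sym (1--involutive x)) (trans (cong 1-_ eq) (1--involutive y))

  1-[1]≡[0] : 1- [ 1 ]ₙ ≡ [ 0 ]ₙ
  1-[1]≡[0] = bar-injective (trans (bar-1- [ 1 ]ₙ) (trans (cong (suc n ∸_) bar[1]) (sym bar[0])))

  1-[0]≡[1] : 1- [ 0 ]ₙ ≡ [ 1 ]ₙ
  1-[0]≡[1] = trans (cong 1-_ (sym 1-[1]≡[0])) (1--involutive [ 1 ]ₙ)

  1-[2]≡[n∸1] : 2 ≤ n → 1- [ 2 ]ₙ ≡ [ n ∸ 1 ]ₙ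
  1-[2]≡[n∸1] 2≤n = trans (sym ([]ₙ-bar (1- [ 2 ]ₙ)))
    (cong [_]ₙ (trans (bar-1- [ 2 ]ₙ) (cong (suc n ∸_) (bar-[]ₙ (s≤s z≤n) 2≤n))))

  mult-oneMinus : ∀ (x : Fin n) ω → mult (1- x) (oneMinus ω) ≡ mult x ω
  mult-oneMinus = mult-map 1--injective

  map-1--oneMinus : ∀ (ω : Seq n) → map 1-_ (oneMinus ω) ≡ ω
  map-1--oneMinus ω = trans (sym (map-∘ ω)) (trans (map-cong 1--involutive ω) (map-id ω))

module _ {n : ℕ} .{{_ : NonZero n}} where

  length≤L : ∀ (ω : Seq n) → length ω ≤ L ω
  length≤L [] = z≤n
  length≤L (y ∷ ω) = +-mono-≤ (0<bar y) (length≤L ω)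

  L-++ : ∀ (xs ys : Seq n) → L (xs ++ ys) ≡ L xs + L ys
  L-++ xs ys = trans (cong sum (map-++ bar xs ys)) (sum-++ (map bar xs) (map bar ys))

  L-mono : ∀ {xs ys : Seq n} → xs ⊆ ys → L xs ≤ L ys
  L-mono [] = z≤n
  L-mono (y ∷ʳ xs⊆ys) = ≤-trans (L-mono xs⊆ys) (m≤n+m _ (bar y))
  L-mono (refl ∷ xs⊆ys) = +-monoʳ-≤ _ (L-mono xs⊆ys)

  L+L-oneMinus : ∀ (ω : Seq n) → L ω + L (oneMinus ω) ≡ length ω * suc n
  L+L-oneMinus [] = refl
  L+L-oneMinus (y ∷ ω) = begin
    (bar y + L ω) + (bar (1- y) + L (oneMinus ω))   ≡⟨ +-interchange (bar y) (L ω) (bar (1- y)) (L (oneMinus ω)) ⟩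
    (bar y + bar (1- y)) + (L ω + L (oneMinus ω))   ≡⟨ cong₂ _+_ (bar+bar-1- y) (L+L-oneMinus ω) ⟩
    suc n + length ω * suc n                        ∎
    where open ≡-Reasoning

  L%n : ∀ (ω : Seq n) → L ω % n ≡ sum (map toℕ ω) % n
  L%n [] = refl
  L%n (y ∷ ω) = begin
    (bar y + L ω) % n                           ≡⟨ %-distribˡ-+ (bar y) (L ω) n ⟩
    (bar y % n + L ω % n) % n                   ≡⟨ cong₂ (λ p q → (p + q) % n) (bar%n y) (L%n ω) ⟩
    (toℕ y % n + sum (map toℕ ω) % n) % n       ≡⟨ %-distribˡ-+ (toℕ y) (sum (map toℕ ω)) n ⟨
    (toℕ y + sum (map toℕ ω)) % n               ∎
    where open ≡-Reasoning

  sumZ≡[0]⇒n∣L : ∀ (ω : Seq n) → sumZ ω ≡ [ 0 ]ₙ → n ∣ L ω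
  sumZ≡[0]⇒n∣L ω sum≡0 = m%n≡0⇒n∣m (L ω) n (begin
    L ω % n                ≡⟨ L%n ω ⟩
    sum (map toℕ ω) % n    ≡⟨ toℕ-[]ₙ (sum (map toℕ ω)) ⟨
    toℕ (sumZ ω)           ≡⟨ cong toℕ sum≡0 ⟩
    toℕ ([_]ₙ {n} 0)       ≡⟨ toℕ-[]ₙ 0 ⟩
    0 % n                  ≡⟨ m<n⇒m%n≡m (>-nonZero⁻¹ n) ⟩
    0                      ∎)
    where open ≡-Reasoning

  ∈⇒bar+length≤1+L : ∀ {x : Fin n} {ω} → x ∈ ω → bar x + length ω ≤ suc (L ω)
  ∈⇒bar+length≤1+L {x} {_ ∷ ω} (here refl) = begin
    bar x + suc (length ω)   ≡⟨ +-suc (bar x) (length ω) ⟩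
    suc (bar x + length ω)   ≤⟨ s≤s (+-monoʳ-≤ (bar x) (length≤L ω)) ⟩
    suc (bar x + L ω)        ∎
    where open ≤-Reasoning
  ∈⇒bar+length≤1+L {x} {y ∷ ω} (there x∈ω) = begin
    bar x + suc (length ω)   ≡⟨ +-suc (bar x) (length ω) ⟩
    suc (bar x + length ω)   ≤⟨ s≤s (∈⇒bar+length≤1+L x∈ω) ⟩
    suc (suc (L ω))          ≤⟨ s≤s (+-monoˡ-≤ (L ω) (0<bar y)) ⟩
    suc (bar y + L ω)        ∎
    where open ≤-Reasoning

  length+length≤mult[1]+L : ∀ (ω : Seq n) → length ω + length ω ≤ mult [ 1 ]ₙ ω + L ω
  length+length≤mult[1]+L [] = z≤n
  length+length≤mult[1]+L (y ∷ ω) with [ 1 ]ₙ ≟ y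
  ... | yes refl = begin
    suc (length ω) + suc (length ω)       ≡⟨ cong suc (+-suc (length ω) (length ω)) ⟩
    2 + (length ω + length ω)             ≤⟨ +-monoʳ-≤ 2 (length+length≤mult[1]+L ω) ⟩
    2 + (mult [ 1 ]ₙ ω + L ω)             ≡⟨ cong suc (+-suc (mult [ 1 ]ₙ ω) (L ω)) ⟨
    suc (mult [ 1 ]ₙ ω) + (1 + L ω)       ≡⟨ cong (λ w → suc (mult [ 1 ]ₙ ω) + (w + L ω)) bar[1] ⟨
    suc (mult [ 1 ]ₙ ω) + (bar y + L ω)   ∎
    where open ≤-Reasoning
  ... | no 1≢y = begin
    suc (length ω) + suc (length ω)       ≡⟨ cong suc (+-suc (length ω) (length ω)) ⟩
    2 + (length ω + length ω)             ≤⟨ +-mono-≤ (≢[1]⇒2≤bar (1≢y ∘ sym)) (length+length≤mult[1]+L ω) ⟩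
    bar y + (mult [ 1 ]ₙ ω + L ω)         ≡⟨ +-left-comm (bar y) (mult [ 1 ]ₙ ω) (L ω) ⟩
    mult [ 1 ]ₙ ω + (bar y + L ω)         ∎
    where open ≤-Reasoning

  mult[1]+L≤length+length⇒[1]or[2] : ∀ (ω : Seq n) → mult [ 1 ]ₙ ω + L ω ≤ length ω + length ω →
                                      All (λ y → y ≡ [ 1 ]ₙ ⊎ y ≡ [ 2 ]ₙ) ω
  mult[1]+L≤length+length⇒[1]or[2] [] _ = []
  mult[1]+L≤length+length⇒[1]or[2] (y ∷ ω) tight with [ 1 ]ₙ ≟ y
  ... | yes refl = inj₁ refl ∷ mult[1]+L≤length+length⇒[1]or[2] ω (+-cancelˡ-≤ 2 _ _ (begin
    2 + (mult [ 1 ]ₙ ω + L ω)             ≡⟨ cong suc (+-suc (mult [ 1 ]ₙ ω) (L ω)) ⟨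
    suc (mult [ 1 ]ₙ ω) + (1 + L ω)       ≡⟨ cong (λ w → suc (mult [ 1 ]ₙ ω) + (w + L ω)) bar[1] ⟨
    suc (mult [ 1 ]ₙ ω) + (bar y + L ω)   ≤⟨ tight ⟩
    suc (length ω) + suc (length ω)       ≡⟨ cong suc (+-suc (length ω) (length ω)) ⟩
    2 + (length ω + length ω)             ∎))
    where open ≤-Reasoning
  ... | no 1≢y with +-tight (≢[1]⇒2≤bar (1≢y ∘ sym)) (length+length≤mult[1]+L ω) (begin
    bar y + (mult [ 1 ]ₙ ω + L ω)         ≡⟨ +-left-comm (bar y) (mult [ 1 ]ₙ ω) (L ω) ⟩
    mult [ 1 ]ₙ ω + (bar y + L ω)         ≤⟨ tight ⟩
    suc (length ω) + suc (length ω)       ≡⟨ cong suc (+-suc (length ω) (length ω)) ⟩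
    2 + (length ω + length ω)             ∎)
    where open ≤-Reasoning
  ... | 2≡bar-y , tail-tight = inj₂ (trans (sym ([]ₙ-bar y)) (cong [_]ₙ (sym 2≡bar-y)))
                             ∷ mult[1]+L≤length+length⇒[1]or[2] ω (≤-reflexive (sym tail-tight))

  mult+length≤L : ∀ {x : Fin n} → x ≢ [ 1 ]ₙ → ∀ ω → mult x ω + length ω ≤ L ω
  mult+length≤L x≢1 [] = z≤n
  mult+length≤L {x} x≢1 (y ∷ ω) with x ≟ y
  ... | yes refl = begin
    suc (mult x ω) + suc (length ω)   ≡⟨ cong suc (+-suc (mult x ω) (length ω)) ⟩
    2 + (mult x ω + length ω)         ≤⟨ +-mono-≤ (≢[1]⇒2≤bar x≢1) (mult+length≤L x≢1 ω) ⟩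
    bar x + L ω                       ∎
    where open ≤-Reasoning
  ... | no _ = begin
    mult x ω + suc (length ω)         ≡⟨ +-suc (mult x ω) (length ω) ⟩
    1 + (mult x ω + length ω)         ≤⟨ +-mono-≤ (0<bar y) (mult+length≤L x≢1 ω) ⟩
    bar y + L ω                       ∎
    where open ≤-Reasoning

-- Sequences of weight less than n

module _ {n : ℕ} .{{_ : NonZero n}} (α : Seq n) (short : L α < n) where

  length<n : length α < n
  length<n = ≤-<-trans (length≤L α) short

  ∈⇒bar+length≤n : ∀ {x} → x ∈ α → bar x + length α ≤ n
  ∈⇒bar+length≤n x∈α = ≤-trans (∈⇒bar+length≤1+L x∈α) short

  [0]∉ : 0 < length α → [ 0 ]ₙ ∉ α
  [0]∉ 0<length 0∈α = <⇒≱ 0<length (+-cancelˡ-≤ n (length α) 0 (begin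
    n + length α            ≡⟨ cong (_+ length α) bar[0] ⟨
    bar [ 0 ]ₙ + length α   ≤⟨ ∈⇒bar+length≤n 0∈α ⟩
    n                       ≡⟨ +-identityʳ n ⟨
    n + 0                   ∎))
    where open ≤-Reasoning

  mult+length<n : ∀ {x} → x ≢ [ 1 ]ₙ → mult x α + length α < n
  mult+length<n x≢1 = ≤-<-trans (mult+length≤L x≢1 α) short

  2*length+1≤mult[1]+n : 2 * length α + 1 ≤ mult [ 1 ]ₙ α + n
  2*length+1≤mult[1]+n = begin
    2 * length α + 1            ≡⟨ +-comm (2 * length α) 1 ⟩
    suc (2 * length α)          ≡⟨ cong suc (2*m≡m+m (length α)) ⟩
    suc (length α + length α)   ≤⟨ s≤s (length+length≤mult[1]+L α) ⟩
    suc (mult [ 1 ]ₙ α + L α)   ≡⟨ +-suc (mult [ 1 ]ₙ α) (L α) ⟨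
    mult [ 1 ]ₙ α + suc (L α)   ≤⟨ +-monoʳ-≤ (mult [ 1 ]ₙ α) short ⟩
    mult [ 1 ]ₙ α + n           ∎
    where open ≤-Reasoning

  ↭-[1][2] : 2 * length α + 1 ≡ mult [ 1 ]ₙ α + n →
             α ↭ replicate (mult [ 1 ]ₙ α) [ 1 ]ₙ ++ replicate (length α ∸ mult [ 1 ]ₙ α) [ 2 ]ₙ
  ↭-[1][2] tight = ↭-two-values (mult[1]+L≤length+length⇒[1]or[2] α (+-cancelʳ-≤ 1 _ _ (begin
    (mult [ 1 ]ₙ α + L α) + 1   ≡⟨ +-comm _ 1 ⟩
    suc (mult [ 1 ]ₙ α + L α)   ≡⟨ +-suc (mult [ 1 ]ₙ α) (L α) ⟨
    mult [ 1 ]ₙ α + suc (L α)   ≤⟨ +-monoʳ-≤ (mult [ 1 ]ₙ α) short ⟩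
    mult [ 1 ]ₙ α + n           ≡⟨ tight ⟨
    2 * length α + 1            ≡⟨ cong (_+ 1) (2*m≡m+m (length α)) ⟩
    (length α + length α) + 1   ∎)))
    where open ≤-Reasoning

sumZ-++≢0 : ∀ {n} .{{_ : NonZero n}} (ω₁ ω₂ : Seq n) → L ω₁ < n → L (oneMinus ω₂) < n →
            length ω₁ + length ω₂ ≡ n → sumZ (ω₁ ++ ω₂) ≢ [ 0 ]ₙ
sumZ-++≢0 {n} ω₁ ω₂ short₁ short₂ length≡n sum≡0 =
  ∤-gap {m = ℓ₂} (sumZ≡[0]⇒n∣L (ω₁ ++ ω₂) sum≡0) L-identity L[1-ω₂]<L[ω₁]+ℓ₂ L[ω₁]+ℓ₂<L[1-ω₂]+n
  where
  ℓ₂ : ℕ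
  ℓ₂ = length ω₂
  L-identity : L (ω₁ ++ ω₂) + L (oneMinus ω₂) ≡ ℓ₂ * n + (L ω₁ + ℓ₂)
  L-identity = begin
    L (ω₁ ++ ω₂) + L (oneMinus ω₂)    ≡⟨ cong (_+ L (oneMinus ω₂)) (L-++ ω₁ ω₂) ⟩
    (L ω₁ + L ω₂) + L (oneMinus ω₂)   ≡⟨ +-assoc (L ω₁) (L ω₂) (L (oneMinus ω₂)) ⟩
    L ω₁ + (L ω₂ + L (oneMinus ω₂))   ≡⟨ cong (L ω₁ +_) (L+L-oneMinus ω₂) ⟩
    L ω₁ + ℓ₂ * suc n                 ≡⟨ cong (L ω₁ +_) (*-suc ℓ₂ n) ⟩
    L ω₁ + (ℓ₂ + ℓ₂ * n)              ≡⟨ +-assoc (L ω₁) ℓ₂ (ℓ₂ * n) ⟨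
    (L ω₁ + ℓ₂) + ℓ₂ * n              ≡⟨ +-comm (L ω₁ + ℓ₂) (ℓ₂ * n) ⟩
    ℓ₂ * n + (L ω₁ + ℓ₂)              ∎
    where open ≡-Reasoning
  L[1-ω₂]<L[ω₁]+ℓ₂ : L (oneMinus ω₂) < L ω₁ + ℓ₂
  L[1-ω₂]<L[ω₁]+ℓ₂ = <-≤-trans short₂ (begin
    n                ≡⟨ length≡n ⟨
    length ω₁ + ℓ₂   ≤⟨ +-monoˡ-≤ ℓ₂ (length≤L ω₁) ⟩
    L ω₁ + ℓ₂        ∎)
    where open ≤-Reasoning
  L[ω₁]+ℓ₂<L[1-ω₂]+n : L ω₁ + ℓ₂ < L (oneMinus ω₂) + n
  L[ω₁]+ℓ₂<L[1-ω₂]+n = subst (L ω₁ + ℓ₂ <_) (+-comm n (L (oneMinus ω₂)))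
    (+-mono-<-≤ short₁ (subst (_≤ L (oneMinus ω₂)) (length-map 1-_ ω₂) (length≤L (oneMinus ω₂))))

-- The hypotheses of the proposition, with n = suc s

module Proposition3 {s k : ℕ} (0<k : 0 < k) (α β : Seq (suc s)) (length-α+β : length α + length β ≡ s + k)
                    (α-short : L α < suc s) (β-short : L (oneMinus β) < suc s) where

  β′ : Seq (suc s)
  β′ = oneMinus β

  A B a b u v : ℕ
  A = length α
  B = length β
  a = mult [ 1 ]ₙ α
  b = mult [ 1 ]ₙ β′
  u = mult [ 1 ]ₙ (α ++ β)
  v = mult [ 0 ]ₙ (α ++ β)

  length-β′ : length β′ ≡ B
  length-β′ = length-map 1-_ β

  A<n : A < suc s
  A<n = length<n α α-short

  B<n : B < suc s
  B<n = subst (_< suc s) length-β′ (length<n β′ β-short)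

  k≤A : k ≤ A
  k≤A = +-cancelˡ-≤ B k A (begin
    B + k   ≤⟨ +-monoˡ-≤ k (s≤s⁻¹ B<n) ⟩
    s + k   ≡⟨ length-α+β ⟨
    A + B   ≡⟨ +-comm A B ⟩
    B + A   ∎)
    where open ≤-Reasoning

  k≤B : k ≤ B
  k≤B = +-cancelˡ-≤ A k B (begin
    A + k   ≤⟨ +-monoˡ-≤ k (s≤s⁻¹ A<n) ⟩
    s + k   ≡⟨ length-α+β ⟨
    A + B   ∎)
    where open ≤-Reasoning

  2≤n : 2 ≤ suc s
  2≤n = s≤s (≤-trans 0<k (s≤s⁻¹ (≤-<-trans k≤A A<n)))

  separation : ∀ x y → x ∈ α → y ∈ β → bar x + k ≤ bar y
  separation x y x∈α y∈β = +-cancelʳ-≤ (bar (1- y) + s) (bar x + k) (bar y) (begin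
    (bar x + k) + (bar (1- y) + s)   ≡⟨ +-interchange (bar x) k (bar (1- y)) s ⟩
    (bar x + bar (1- y)) + (k + s)   ≡⟨ cong ((bar x + bar (1- y)) +_) (trans (+-comm k s) (sym length-α+β)) ⟩
    (bar x + bar (1- y)) + (A + B)   ≡⟨ +-interchange (bar x) (bar (1- y)) A B ⟩
    (bar x + A) + (bar (1- y) + B)   ≤⟨ +-mono-≤ (∈⇒bar+length≤n α α-short x∈α) 1-y-bound ⟩
    suc s + suc s                    ≡⟨ +-suc (suc s) s ⟩
    suc (suc s) + s                  ≡⟨ cong (_+ s) (bar+bar-1- y) ⟨
    (bar y + bar (1- y)) + s         ≡⟨ +-assoc (bar y) (bar (1- y)) s ⟩
    bar y + (bar (1- y) + s)         ∎)
    where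
    open ≤-Reasoning
    1-y-bound : bar (1- y) + B ≤ suc s
    1-y-bound = subst (λ ℓ → bar (1- y) + ℓ ≤ suc s) length-β′ (∈⇒bar+length≤n β′ β-short (∈-map⁺ 1-_ y∈β))

  disjoint : ∀ x y → x ∈ α → y ∈ β → x ≢ y
  disjoint x y x∈α y∈β refl = <⇒≱ 0<k (+-cancelˡ-≤ (bar x) k 0
    (subst (bar x + k ≤_) (sym (+-identityʳ (bar x))) (separation x y x∈α y∈β)))

  [0]∉α : [ 0 ]ₙ ∉ α
  [0]∉α = [0]∉ α α-short (<-≤-trans 0<k k≤A)

  [1]∉β : [ 1 ]ₙ ∉ β
  [1]∉β 1∈β = [0]∉ β′ β-short (<-≤-trans 0<k (≤-trans k≤B (≤-reflexive (sym length-β′))))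
    (subst (_∈ β′) 1-[1]≡[0] (∈-map⁺ 1-_ 1∈β))

  u≡a : u ≡ a
  u≡a = mult-++-∉ʳ α [1]∉β

  v≡b : v ≡ b
  v≡b = begin
    v                     ≡⟨ mult-++-∉ˡ β [0]∉α ⟩
    mult [ 0 ]ₙ β         ≡⟨ mult-oneMinus [ 0 ]ₙ β ⟨
    mult (1- [ 0 ]ₙ) β′   ≡⟨ cong (λ x → mult x β′) 1-[0]≡[1] ⟩
    b                     ∎
    where open ≡-Reasoning

  a≤A : a ≤ A
  a≤A = mult≤length [ 1 ]ₙ α

  b≤B : b ≤ B
  b≤B = subst (b ≤_) length-β′ (mult≤length [ 1 ]ₙ β′)

  α-bound : 2 * A + 1 ≤ a + suc s
  α-bound = 2*length+1≤mult[1]+n α α-short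

  β-bound : 2 * B + 1 ≤ b + suc s
  β-bound = subst (λ ℓ → 2 * ℓ + 1 ≤ b + suc s) length-β′ (2*length+1≤mult[1]+n β′ β-short)

  2*k≤a+b : 2 * k ≤ a + b
  2*k≤a+b = +-cancelʳ-≤ (suc s + suc s) (2 * k) (a + b) (begin
    2 * k + (suc s + suc s)     ≡⟨ [2*p+1]+[2*q+1]≡2*k+[n+n] {A} {B} length-α+β ⟨
    (2 * A + 1) + (2 * B + 1)   ≤⟨ +-mono-≤ α-bound β-bound ⟩
    (a + suc s) + (b + suc s)   ≡⟨ +-interchange a (suc s) b (suc s) ⟩
    (a + b) + (suc s + suc s)   ∎)
    where open ≤-Reasoning

  a+b≤2*k⇒tight : a + b ≤ 2 * k → 2 * A + 1 ≡ a + suc s × 2 * B + 1 ≡ b + suc s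
  a+b≤2*k⇒tight a+b≤2k = +-tight α-bound β-bound (begin
    (a + suc s) + (b + suc s)   ≡⟨ +-interchange a (suc s) b (suc s) ⟩
    (a + b) + (suc s + suc s)   ≤⟨ +-monoˡ-≤ (suc s + suc s) a+b≤2k ⟩
    2 * k + (suc s + suc s)     ≡⟨ [2*p+1]+[2*q+1]≡2*k+[n+n] {A} {B} length-α+β ⟨
    (2 * A + 1) + (2 * B + 1)   ∎)
    where open ≤-Reasoning

  α-shape : 2 * A + 1 ≡ a + suc s → α ↭ replicate a [ 1 ]ₙ ++ replicate (s ∸ A) [ 2 ]ₙ
  α-shape tight = subst (λ d → α ↭ replicate a [ 1 ]ₙ ++ replicate d [ 2 ]ₙ)
    (tight⇒m∸a≡s∸m A tight a≤A) (↭-[1][2] α α-short tight)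

  β-shape : 2 * B + 1 ≡ b + suc s → β ↭ replicate b [ 0 ]ₙ ++ replicate (s ∸ B) [ s ]ₙ
  β-shape tight = begin
    β                                                              ≡⟨ map-1--oneMinus β ⟨
    map 1-_ β′                                                     ↭⟨ ↭-map⁺ 1-_ (↭-[1][2] β′ β-short tight′) ⟩
    map 1-_ (replicate b [ 1 ]ₙ ++ replicate (length β′ ∸ b) [ 2 ]ₙ)
      ≡⟨ map-++ 1-_ (replicate b [ 1 ]ₙ) _ ⟩
    map 1-_ (replicate b [ 1 ]ₙ) ++ map 1-_ (replicate (length β′ ∸ b) [ 2 ]ₙ)
      ≡⟨ cong₂ _++_ (map-replicate 1-_ b [ 1 ]ₙ) (map-replicate 1-_ (length β′ ∸ b) [ 2 ]ₙ) ⟩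
    replicate b (1- [ 1 ]ₙ) ++ replicate (length β′ ∸ b) (1- [ 2 ]ₙ)
      ≡⟨ cong₂ (λ x d → replicate b x ++ replicate d (1- [ 2 ]ₙ)) 1-[1]≡[0] B∸b≡s∸B ⟩
    replicate b [ 0 ]ₙ ++ replicate (s ∸ B) (1- [ 2 ]ₙ)
      ≡⟨ cong (λ y → replicate b [ 0 ]ₙ ++ replicate (s ∸ B) y) (1-[2]≡[n∸1] 2≤n) ⟩
    replicate b [ 0 ]ₙ ++ replicate (s ∸ B) [ s ]ₙ                 ∎
    where
    open PermutationReasoning
    tight′ : 2 * length β′ + 1 ≡ b + suc s
    tight′ = subst (λ ℓ → 2 * ℓ + 1 ≡ b + suc s) (sym length-β′) tight
    B∸b≡s∸B : length β′ ∸ b ≡ s ∸ B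
    B∸b≡s∸B = trans (cong (_∸ b) length-β′) (tight⇒m∸a≡s∸m B tight b≤B)

  α-shape⇒u≡ : ∀ c d → α ↭ replicate c [ 1 ]ₙ ++ replicate d [ 2 ]ₙ → u ≡ c
  α-shape⇒u≡ c d α↭ = trans u≡a (trans (mult-↭ [ 1 ]ₙ α↭) (mult-replicate-++ c d ([1]≢[2] 2≤n)))

  β-shape⇒v≡ : ∀ c d → β ↭ replicate c [ 0 ]ₙ ++ replicate d [ s ]ₙ → v ≡ c
  β-shape⇒v≡ c d β↭ =
    trans (mult-++-∉ˡ β [0]∉α) (trans (mult-↭ [ 0 ]ₙ β↭) (mult-replicate-++ c d ([0]≢[n∸1] 2≤n)))

  no-zero-sum : ¬ (Σ (Seq (suc s)) λ ω → (ω ⊆ α ++ β) × (length ω ≡ suc s) × (sumZ ω ≡ [ 0 ]ₙ))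
  no-zero-sum (ω , ω⊆α++β , length≡n , sum≡0) with ⊆-++⁻ α ω⊆α++β
  ... | ω₁ , ω₂ , refl , ω₁⊆α , ω₂⊆β = sumZ-++≢0 ω₁ ω₂
    (≤-<-trans (L-mono ω₁⊆α) α-short) (≤-<-trans (L-mono (⊆-map⁺ 1-_ ω₂⊆β)) β-short)
    (trans (sym (length-++ ω₁)) length≡n) sum≡0

  2*k≤u+v : 2 * k ≤ u + v
  2*k≤u+v = subst (2 * k ≤_) (sym (cong₂ _+_ u≡a v≡b)) 2*k≤a+b

  k≤u⊔v : k ≤ u ⊔ v
  k≤u⊔v = *-cancelˡ-≤ 2 (begin
    2 * k               ≤⟨ 2*k≤u+v ⟩
    u + v               ≤⟨ +-mono-≤ (m≤m⊔n u v) (m≤n⊔m u v) ⟩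
    (u ⊔ v) + (u ⊔ v)   ≡⟨ 2*m≡m+m (u ⊔ v) ⟨
    2 * (u ⊔ v)         ∎)
    where open ≤-Reasoning

  2*k+1∸n≤u⊓v : 2 * k + 1 ∸ suc s ≤ u ⊓ v
  2*k+1∸n≤u⊓v = ⊓-glb (subst (_ ≤_) (sym u≡a) (2*k+1∸n≤x k≤A α-bound))
                      (subst (_ ≤_) (sym v≡b) (2*k+1∸n≤x k≤B β-bound))

  ShapeForMinimalSum : Set
  ShapeForMinimalSum = ∃₂ λ p q → s ≤ 2 * p × p < suc s × s ≤ 2 * q × q < suc s × p + q ≡ s + k
    × α ↭ (replicate (2 * p + 1 ∸ suc s) [ 1 ]ₙ ++ replicate (s ∸ p) [ 2 ]ₙ)
    × β ↭ (replicate (2 * q + 1 ∸ suc s) [ 0 ]ₙ ++ replicate (s ∸ q) [ s ]ₙ)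

  u+v≡2*k⇒shape : u + v ≡ 2 * k → ShapeForMinimalSum
  u+v≡2*k⇒shape u+v≡2k with a+b≤2*k⇒tight (≤-reflexive (trans (sym (cong₂ _+_ u≡a v≡b)) u+v≡2k))
  ... | α-tight , β-tight = A , B , tight⇒s≤2*m A α-tight , A<n , tight⇒s≤2*m B β-tight , B<n , length-α+β
    , subst (λ c → α ↭ replicate c [ 1 ]ₙ ++ replicate (s ∸ A) [ 2 ]ₙ)
        (tight⇒a≡2*m+1∸n A α-tight) (α-shape α-tight)
    , subst (λ c → β ↭ replicate c [ 0 ]ₙ ++ replicate (s ∸ B) [ s ]ₙ)
        (tight⇒a≡2*m+1∸n B β-tight) (β-shape β-tight)

  shape⇒u+v≡2*k : ShapeForMinimalSum → u + v ≡ 2 * k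
  shape⇒u+v≡2*k (p , q , s≤2p , _ , s≤2q , _ , p+q≡s+k , α↭ , β↭) = begin
    u + v
      ≡⟨ cong₂ _+_ (α-shape⇒u≡ _ (s ∸ p) α↭) (β-shape⇒v≡ _ (s ∸ q) β↭) ⟩
    (2 * p + 1 ∸ suc s) + (2 * q + 1 ∸ suc s)
      ≡⟨ [2*p+1∸n]+[2*q+1∸n]≡2*k {p} {q} s≤2p s≤2q p+q≡s+k ⟩
    2 * k
      ∎
    where open ≡-Reasoning

  ShapeForMinimalMax : Set
  ShapeForMinimalMax = suc s % 2 ≢ k % 2
    × α ↭ (replicate k [ 1 ]ₙ ++ replicate ((s ∸ k) / 2) [ 2 ]ₙ)
    × β ↭ (replicate k [ 0 ]ₙ ++ replicate ((s ∸ k) / 2) [ s ]ₙ)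

  u⊔v≡k⇒a≡k×b≡k : u ⊔ v ≡ k → a ≡ k × b ≡ k
  u⊔v≡k⇒a≡k×b≡k u⊔v≡k =
    +-tight (subst₂ _≤_ u≡a u⊔v≡k (m≤m⊔n u v)) (subst₂ _≤_ v≡b u⊔v≡k (m≤n⊔m u v))
            (subst (_≤ a + b) (2*m≡m+m k) 2*k≤a+b)

  u⊔v≡k⇒shape : u ⊔ v ≡ k → ShapeForMinimalMax
  u⊔v≡k⇒shape u⊔v≡k with u⊔v≡k⇒a≡k×b≡k u⊔v≡k
  ... | a≡k , b≡k with a+b≤2*k⇒tight (≤-reflexive (trans (cong₂ _+_ a≡k b≡k) (sym (2*m≡m+m k))))
  ... | α-tight , β-tight = tight⇒parity A α-tightₖ k≤A
    , subst₂ (λ c d → α ↭ replicate c [ 1 ]ₙ ++ replicate d [ 2 ]ₙ)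
        a≡k (tight⇒s∸m≡[s∸a]/2 A α-tightₖ k≤A) (α-shape α-tight)
    , subst₂ (λ c d → β ↭ replicate c [ 0 ]ₙ ++ replicate d [ s ]ₙ)
        b≡k (tight⇒s∸m≡[s∸a]/2 B β-tightₖ k≤B) (β-shape β-tight)
    where
    α-tightₖ : 2 * A + 1 ≡ k + suc s
    α-tightₖ = trans α-tight (cong (_+ suc s) a≡k)
    β-tightₖ : 2 * B + 1 ≡ k + suc s
    β-tightₖ = trans β-tight (cong (_+ suc s) b≡k)

  shape⇒u⊔v≡k : ShapeForMinimalMax → u ⊔ v ≡ k
  shape⇒u⊔v≡k (_ , α↭ , β↭) = begin
    u ⊔ v   ≡⟨ cong₂ _⊔_ (α-shape⇒u≡ k ((s ∸ k) / 2) α↭) (β-shape⇒v≡ k ((s ∸ k) / 2) β↭) ⟩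
    k ⊔ k   ≡⟨ ⊔-idem k ⟩
    k       ∎
    where open ≡-Reasoning

  highestMult≡u⊔v : s ≤ 2 * k → highestMult (α ++ β) ≡ u ⊔ v
  highestMult≡u⊔v s≤2k = ≤-antisym (highestMult-lub (α ++ β) bound)
    (⊔-lub (mult≤highestMult (α ++ β) [ 1 ]ₙ) (mult≤highestMult (α ++ β) [ 0 ]ₙ))
    where
    open ≤-Reasoning
    bound : ∀ {x} → x ∈ α ++ β → mult x (α ++ β) ≤ u ⊔ v
    bound {x} x∈α++β with x ≟ [ 1 ]ₙ | x ≟ [ 0 ]ₙ | ∈-++⁻ α x∈α++β
    ... | yes refl | _ | _ = m≤m⊔n u v
    ... | no _ | yes refl | _ = m≤n⊔m u v
    ... | no x≢1 | no _ | inj₁ x∈α = begin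
      mult x (α ++ β)   ≡⟨ mult-++-∉ʳ α (λ x∈β → disjoint x x x∈α x∈β refl) ⟩
      mult x α          ≤⟨ c+m<1+s⇒c≤k (mult+length<n α α-short x≢1) k≤A s≤2k ⟩
      k                 ≤⟨ k≤u⊔v ⟩
      u ⊔ v             ∎
    ... | no _ | no x≢0 | inj₂ x∈β = begin
      mult x (α ++ β)   ≡⟨ mult-++-∉ˡ β (λ x∈α → disjoint x x x∈α x∈β refl) ⟩
      mult x β          ≡⟨ mult-oneMinus x β ⟨
      mult (1- x) β′    ≤⟨ c+m<1+s⇒c≤k 1-x-bound k≤B s≤2k ⟩
      k                 ≤⟨ k≤u⊔v ⟩
      u ⊔ v             ∎
      where
      1-x≢1 : 1- x ≢ [ 1 ]ₙ
      1-x≢1 1-x≡1 = x≢0 (trans (sym (1--involutive x)) (trans (cong 1-_ 1-x≡1) 1-[1]≡[0]))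
      1-x-bound : mult (1- x) β′ + B < suc s
      1-x-bound = subst (λ ℓ → mult (1- x) β′ + ℓ < suc s) length-β′ (mult+length<n β′ β-short 1-x≢1)

proposition3 : (n k : ℕ) .{{_ : NonZero n}} → 0 < k → k < n →
  (α β : Seq n) → length α + length β ≡ n ∸ 1 + k →
  L α < n → L (oneMinus β) < n →
  let u = mult [ 1 ]ₙ (α ++ β)
      v = mult [ 0 ]ₙ (α ++ β)
  in
  -- (a)
  (¬ (Σ (Seq n) λ ω → (ω ⊆ α ++ β) × (length ω ≡ n) × (sumZ ω ≡ [ 0 ]ₙ)))
  -- (b)
  × (k ≤ length α × length α < n × k ≤ length β × length β < n
     × (∀ a b → a ∈ α → b ∈ β → bar a + k ≤ bar b)
     × (∀ a b → a ∈ α → b ∈ β → ¬ (a ≡ b)))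
  -- (c)
  × (2 * k ≤ u + v × k ≤ u ⊔ v × 2 * k + 1 ∸ n ≤ u ⊓ v
     × ((u + v ≡ 2 * k) ⇔
          (∃₂ λ p q → n ∸ 1 ≤ 2 * p × p < n × n ∸ 1 ≤ 2 * q × q < n
             × p + q ≡ n ∸ 1 + k
             × α ↭ (replicate (2 * p + 1 ∸ n) [ 1 ]ₙ ++ replicate (n ∸ 1 ∸ p) [ 2 ]ₙ)
             × β ↭ (replicate (2 * q + 1 ∸ n) [ 0 ]ₙ ++ replicate (n ∸ 1 ∸ q) [ n ∸ 1 ]ₙ)))
     × ((u ⊔ v ≡ k) ⇔
          (¬ (n % 2 ≡ k % 2)
             × α ↭ (replicate k [ 1 ]ₙ ++ replicate ((n ∸ 1 ∸ k) / 2) [ 2 ]ₙ)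
             × β ↭ (replicate k [ 0 ]ₙ ++ replicate ((n ∸ 1 ∸ k) / 2) [ n ∸ 1 ]ₙ))))
  -- (d)
  × (n ∸ 1 ≤ 2 * k → highestMult (α ++ β) ≡ u ⊔ v)
-- n = 0 is excluded by the NonZero instance, and k < n follows from k ≤ length α < n.
proposition3 (suc s) k 0<k _ α β length-α+β α-short β-short =
    no-zero-sum
  , (k≤A , A<n , k≤B , B<n , separation , disjoint)
  , (2*k≤u+v , k≤u⊔v , 2*k+1∸n≤u⊓v
    , mk⇔ u+v≡2*k⇒shape shape⇒u+v≡2*k
    , mk⇔ u⊔v≡k⇒shape shape⇒u⊔v≡k)
  , highestMult≡u⊔v
  where open Proposition3 0<k α β length-α+β α-short β-short
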